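{- Let $S$ be a cosimplicial complex and let $\sigma,\tau,\nu\in S$ with $\sigma\subseteq\tau$. Then: (i) $\overline{S}\setminus\{\sigma,\tau\}$ is an elementary collapse of $\overline{S}$ (via the pair $(\sigma,\tau)$) if and only if $S\setminus\{\sigma,\tau\}$ is a reduction of $S$; (ii) $\overline{S}\setminus\{\nu\}$ is an elementary perforation of $\overline{S}$ if and only if $S\setminus\{\nu\}$ is a perforation of $S$; (iii) $\underline{S}\cup\{\sigma,\tau\}$ is an elementary expansion of $\underline{S}$ (via the pair $(\sigma,\tau)$) if and only if $S\setminus\{\sigma,\tau\}$ is a coreduction of $S$; (iv) $\underline{S}\cup\{\nu\}$ is an elementary filling of $\underline{S}$ if and only if $S\setminus\{\nu\}$ is a coperforation of $S$.
   Context: A simplicial complex is a finite family $K$ of non-empty finite sets (simplexes) closed under taking non-empty subsets; its elements are faces, a facet is a face maximal for inclusion, and $\dim(\sigma)=|\sigma|-1$. For $\sigma\in K$: $\partial(\sigma,K)=\{\mu\in K:\mu\subseteq\sigma,\ \dim\mu=\dim\sigma-1\}$ and $\delta(\sigma,K)=\{\mu\in K:\sigma\subseteq\mu,\ \dim\mu=\dim\sigma+1\}$. A pair $(\sigma,\tau)$ of faces of $K$ with $\sigma\subsetneq\tau$ is a free pair for $K$ if $\tau$ is the only face of $K$ other than $\sigma$ containing $\sigma$; then $K\setminus\{\sigma,\tau\}$ is an elementary collapse of $K$ and $K$ is an elementary expansion of $K\setminus\{\sigma,\tau\}$. If $\nu$ is a facet of $K$, then $K\setminus\{\nu\}$ is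 an elementary perforation of $K$ and $K$ is an elementary filling of $K\setminus\{\nu\}$. A finite set $S$ of simplexes is a cosimplicial complex if $\nu\in S$ whenever $\sigma\subseteq\nu\subseteq\tau$ with $\sigma,\tau\in S$. $\overline{S}$ is the set of all simplexes contained in some element of $S$, and $\underline{S}=\overline{S}\setminus S$ (both are simplicial complexes when $S$ is cosimplicial). For $\nu\in S$: $\partial(\nu,S)=\partial(\nu,\overline{S})\cap S$ and $\delta(\nu,S)=\delta(\nu,\overline{S})$. For $\sigma,\tau,\nu\in S$ with $\sigma\subseteq\tau$: $S\setminus\{\sigma,\tau\}$ is a reduction of $S$ if $\delta(\sigma,S)=\{\tau\}$; $S\setminus\{\nu\}$ is a perforation of $S$ if $\delta(\nu,S)=\emptyset$; $S\setminus\{\sigma,\tau\}$ is a coreduction of $S$ if $\partial(\tau,S)=\{\sigma\}$; $S\setminus\{\nu\}$ is a coperforation of $S$ if $\partial(\nu,S)=\emptyset$. -}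

module Defs where

open import Data.Nat using (ℕ; suc)
open import Data.Fin.Subset using (Subset; _⊆_; Nonempty; ∣_∣)
open import Data.Product using (_×_; ∃-syntax)
open import Data.Sum using (_⊎_)
open import Relation.Nullary using (¬_)
open import Relation.Binary.PropositionalEquality using (_≡_; _≢_)
open import Function.Bundles using (_⇔_)

-- Vertices are drawn from Fin n (any finite family of finite sets has a
-- finite vertex set, so this is no loss of generality).  A simplex is a
-- subset of Fin n (non-emptiness is imposed by the complexes below).
-- A finite set of simplexes is a predicate on Subset n (finite automatically).
Family : ℕ → Set₁
Family n = Subset n → Set

IsSimplicialComplex : ∀ {n} → Family n → Set
IsSimplicialComplex {n} K =
  (∀ ν → K ν → Nonempty ν) ×
  (∀ (μ ν : Subset n) → K ν → Nonempty μ → μ ⊆ ν → K μ)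

IsCosimplicial : ∀ {n} → Family n → Set
IsCosimplicial {n} S =
  (∀ ν → S ν → Nonempty ν) ×
  (∀ (σ ν τ : Subset n) → S σ → S τ → σ ⊆ ν → ν ⊆ τ → S ν)

closure : ∀ {n} → Family n → Family n
closure S ν = Nonempty ν × ∃[ τ ] (S τ × ν ⊆ τ)

under : ∀ {n} → Family n → Family n
under S ν = closure S ν × ¬ S ν

insert₁ : ∀ {n} → Family n → Subset n → Family n
insert₁ K σ ν = K ν ⊎ ν ≡ σ

insert₂ : ∀ {n} → Family n → Subset n → Subset n → Family n
insert₂ K σ τ ν = K ν ⊎ ν ≡ σ ⊎ ν ≡ τ

-- ∂(σ,K) and δ(σ,K) as predicates (dim μ = dim σ ∓ 1 via cardinalities)
bd : ∀ {n} → Family n → Subset n → Family n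
bd K σ μ = K μ × μ ⊆ σ × suc ∣ μ ∣ ≡ ∣ σ ∣

cobd : ∀ {n} → Family n → Subset n → Family n
cobd K σ μ = K μ × σ ⊆ μ × ∣ μ ∣ ≡ suc ∣ σ ∣

bdS : ∀ {n} → Family n → Subset n → Family n
bdS S ν μ = bd (closure S) ν μ × S μ

cobdS : ∀ {n} → Family n → Subset n → Family n
cobdS S ν = cobd (closure S) ν

FreePair : ∀ {n} → Family n → Subset n → Subset n → Set
FreePair K σ τ =
  K σ × K τ × σ ⊆ τ × σ ≢ τ ×
  (∀ ρ → K ρ → σ ⊆ ρ → ρ ≢ σ → ρ ≡ τ)

Facet : ∀ {n} → Family n → Subset n → Set
Facet K ν = K ν × (∀ μ → K μ → ν ⊆ μ → μ ≡ ν)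

ElemCollapse : ∀ {n} → Family n → Subset n → Subset n → Set
ElemCollapse K σ τ = FreePair K σ τ

ElemPerforation : ∀ {n} → Family n → Subset n → Set
ElemPerforation K ν = Facet K ν

-- L ∪ {σ,τ} is an elementary expansion of L via (σ,τ):
-- K = L ∪ {σ,τ} is a simplicial complex, (σ,τ) is a free pair for K,
-- and σ, τ ∉ L (so that K \ {σ,τ} = L)
ElemExpansion : ∀ {n} → Family n → Subset n → Subset n → Set
ElemExpansion L σ τ =
  IsSimplicialComplex (insert₂ L σ τ) × FreePair (insert₂ L σ τ) σ τ ×
  ¬ L σ × ¬ L τ

ElemFilling : ∀ {n} → Family n → Subset n → Set
ElemFilling L ν =
  IsSimplicialComplex (insert₁ L ν) × Facet (insert₁ L ν) ν × ¬ L ν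

Reduction : ∀ {n} → Family n → Subset n → Subset n → Set
Reduction S σ τ = ∀ μ → cobdS S σ μ ⇔ μ ≡ τ

Perforation : ∀ {n} → Family n → Subset n → Set
Perforation S ν = ∀ μ → ¬ cobdS S ν μ

Coreduction : ∀ {n} → Family n → Subset n → Subset n → Set
Coreduction S σ τ = ∀ μ → bdS S τ μ ⇔ μ ≡ σ

Coperforation : ∀ {n} → Family n → Subset n → Set
Coperforation S ν = ∀ μ → ¬ bdS S ν μ

{-# OPTIONS --safe #-}
module Submission where

-- In a simplicial complex every coface ρ ⊋ σ contains the codimension-one
-- cofaces σ ∪ {y}, y ∈ ρ ∖ σ.  Hence (σ,τ) is free iff τ is the only
-- codimension-one coface of σ, and ν is a facet iff it has none; applied to
-- the simplicial complex \overline{S} this is (i) and (ii).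
-- For (iii) and (iv), cosimpliciality of S makes \underline{S} closed
-- downwards and keeps it off everything above an element of S, so
-- \underline{S} ∪ P (with P ⊆ S) is a simplicial complex exactly when the
-- S-faces of members of P lie in P.  A proper S-face μ ⊊ τ produces, by
-- betweenness, the codimension-one S-faces τ ∖ {x} for x ∈ τ ∖ μ, which ties
-- this condition to ∂(τ,S).

open import Defs
open import Data.Nat using (ℕ; suc)
open import Data.Nat.Properties using (1+n≢n)
open import Data.Bool.Properties using () renaming (_≟_ to _≟ᵇ_)
open import Data.Fin using (Fin; zero; suc)
open import Data.Fin.Properties using (any?)
open import Data.Fin.Subset
  using (Subset; _⊆_; _⊂_; _∈_; _∉_; _∪_; _-_; ⁅_⁆; ∣_∣; Nonempty; inside; outside)
open import Data.Fin.Subset.Properties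
  using (_∈?_; ⊆-refl; ⊆-trans; ⊆-antisym; p⊆p∪q; q⊆p∪q; x∈p∪q⁻; x∈⁅x⁆; x∈⁅y⁆⇒x≡y;
         p─⊥≡p; p─q⊆p; x∈p∧x≢y⇒x∈p-y)
open import Data.Vec using (_∷_; here; there)
open import Data.Vec.Properties using (≡-dec)
open import Data.Product using (_×_; _,_; proj₁; proj₂)
open import Data.Sum using (_⊎_; inj₁; inj₂; [_,_])
open import Function using (_∘_; id)
open import Function.Bundles using (_⇔_; mk⇔; Equivalence)
open import Relation.Binary.Definitions using (DecidableEquality)
open import Relation.Binary.PropositionalEquality
  using (_≡_; _≢_; refl; sym; trans; cong; subst; ≢-sym)
open import Relation.Nullary using (¬_; yes; no; contradiction)
open import Relation.Nullary.Decidable using (¬?; _×-dec_; decidable-stable)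

private
  variable
    n : ℕ
    x : Fin n
    p q r σ τ μ ν ρ : Subset n
    K P S : Family n

_≟ₛ_ : DecidableEquality (Subset n)
_≟ₛ_ = ≡-dec _≟ᵇ_

⊆∧≢⇒⊂ : p ⊆ q → p ≢ q → p ⊂ q
⊆∧≢⇒⊂ {p = p} {q} p⊆q p≢q with any? (λ x → x ∈? q ×-dec ¬? (x ∈? p))
... | yes q∖p≢∅ = p⊆q , q∖p≢∅
... | no  q∖p≡∅ = contradiction (⊆-antisym p⊆q q⊆p) p≢q
  where
  q⊆p : q ⊆ p
  q⊆p {x} x∈q = decidable-stable (x ∈? p) (λ x∉p → q∖p≡∅ (x , x∈q , x∉p))

∣p∣≡1+∣q∣⇒p≢q : ∣ p ∣ ≡ suc ∣ q ∣ → p ≢ q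
∣p∣≡1+∣q∣⇒p≢q card refl = 1+n≢n (sym card)

x∉p-x : ∀ (p : Subset n) x → x ∉ p - x
x∉p-x (_ ∷ p) zero    ()
x∉p-x (_ ∷ p) (suc x) (there x∈p-x) = x∉p-x p x x∈p-x

x∈p⇒1+∣p-x∣≡∣p∣ : x ∈ p → suc ∣ p - x ∣ ≡ ∣ p ∣
x∈p⇒1+∣p-x∣≡∣p∣ {p = _ ∷ p}       here  = cong (suc ∘ ∣_∣) (p─⊥≡p p)
x∈p⇒1+∣p-x∣≡∣p∣ {p = outside ∷ _} (there x∈p) = x∈p⇒1+∣p-x∣≡∣p∣ x∈p
x∈p⇒1+∣p-x∣≡∣p∣ {p = inside  ∷ _} (there x∈p) = cong suc (x∈p⇒1+∣p-x∣≡∣p∣ x∈p)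

p⊆q∧x∉p⇒p⊆q-x : p ⊆ q → x ∉ p → p ⊆ q - x
p⊆q∧x∉p⇒p⊆q-x p⊆q x∉p y∈p = x∈p∧x≢y⇒x∈p-y (p⊆q y∈p) (λ { refl → x∉p y∈p })

p⊆r∧x∈r⇒p∪⁅x⁆⊆r : p ⊆ r → x ∈ r → p ∪ ⁅ x ⁆ ⊆ r
p⊆r∧x∈r⇒p∪⁅x⁆⊆r {p = p} {x = x} p⊆r x∈r y∈p∪⁅x⁆ with x∈p∪q⁻ p ⁅ x ⁆ y∈p∪⁅x⁆
... | inj₁ y∈p    = p⊆r y∈p
... | inj₂ y∈⁅x⁆ = subst (_∈ _) (sym (x∈⁅y⁆⇒x≡y x y∈⁅x⁆)) x∈r

x∉p⇒p∪⁅x⁆-x≡p : x ∉ p → p ∪ ⁅ x ⁆ - x ≡ p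
x∉p⇒p∪⁅x⁆-x≡p {x = x} {p} x∉p = ⊆-antisym ⊆p p⊆
  where
  ⊆p : p ∪ ⁅ x ⁆ - x ⊆ p
  ⊆p {y} y∈ with x∈p∪q⁻ p ⁅ x ⁆ (p─q⊆p _ ⁅ x ⁆ y∈)
  ... | inj₁ y∈p    = y∈p
  ... | inj₂ y∈⁅x⁆ = contradiction (subst (_∈ _) (x∈⁅y⁆⇒x≡y x y∈⁅x⁆) y∈) (x∉p-x _ x)
  p⊆ : p ⊆ p ∪ ⁅ x ⁆ - x
  p⊆ = p⊆q∧x∉p⇒p⊆q-x (p⊆p∪q ⁅ x ⁆) x∉p

x∉p⇒∣p∪⁅x⁆∣≡1+∣p∣ : x ∉ p → ∣ p ∪ ⁅ x ⁆ ∣ ≡ suc ∣ p ∣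
x∉p⇒∣p∪⁅x⁆∣≡1+∣p∣ {x = x} {p} x∉p = trans
  (sym (x∈p⇒1+∣p-x∣≡∣p∣ (q⊆p∪q p ⁅ x ⁆ (x∈⁅x⁆ x))))
  (cong (suc ∘ ∣_∣) (x∉p⇒p∪⁅x⁆-x≡p x∉p))

module _ (K-simplicial : IsSimplicialComplex K) where

  cobd-add : K ρ → σ ⊆ ρ → x ∈ ρ → x ∉ σ → cobd K σ (σ ∪ ⁅ x ⁆)
  cobd-add {σ = σ} {x} Kρ σ⊆ρ x∈ρ x∉σ =
    proj₂ K-simplicial _ _ Kρ (x , q⊆p∪q σ ⁅ x ⁆ (x∈⁅x⁆ x)) (p⊆r∧x∈r⇒p∪⁅x⁆⊆r σ⊆ρ x∈ρ) ,
    p⊆p∪q ⁅ x ⁆ ,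
    x∉p⇒∣p∪⁅x⁆∣≡1+∣p∣ x∉σ

  freePair⇒cobd : FreePair K σ τ → cobd K σ τ
  freePair⇒cobd {σ = σ} (_ , Kτ , σ⊆τ , σ≢τ , free) with ⊆∧≢⇒⊂ σ⊆τ σ≢τ
  ... | _ , x , x∈τ , x∉σ with cobd-add Kτ σ⊆τ x∈τ x∉σ
  ...   | cobd-σ∪⁅x⁆@(Kσ∪⁅x⁆ , σ⊆σ∪⁅x⁆ , card) =
    subst (cobd K σ) (free _ Kσ∪⁅x⁆ σ⊆σ∪⁅x⁆ (∣p∣≡1+∣q∣⇒p≢q card)) cobd-σ∪⁅x⁆

  uniqueCobd⇒freePair : K σ → (∀ μ → cobd K σ μ ⇔ μ ≡ τ) → FreePair K σ τ
  uniqueCobd⇒freePair {σ = σ} {τ} Kσ δσ≡⁅τ⁆ with Equivalence.from (δσ≡⁅τ⁆ τ) refl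
  ... | Kτ , σ⊆τ , ∣τ∣≡1+∣σ∣ = Kσ , Kτ , σ⊆τ , ≢-sym (∣p∣≡1+∣q∣⇒p≢q ∣τ∣≡1+∣σ∣) , free
    where
    free : ∀ ρ → K ρ → σ ⊆ ρ → ρ ≢ σ → ρ ≡ τ
    free ρ Kρ σ⊆ρ ρ≢σ with ⊆∧≢⇒⊂ σ⊆ρ (≢-sym ρ≢σ)
    ... | _ , x , x∈ρ , x∉σ = ⊆-antisym ρ⊆τ τ⊆ρ
      where
      σ∪⁅y⁆≡τ : ∀ {y} → y ∈ ρ → y ∉ σ → σ ∪ ⁅ y ⁆ ≡ τ
      σ∪⁅y⁆≡τ y∈ρ y∉σ = Equivalence.to (δσ≡⁅τ⁆ _) (cobd-add Kρ σ⊆ρ y∈ρ y∉σ)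
      ρ⊆τ : ρ ⊆ τ
      ρ⊆τ {y} y∈ρ with y ∈? σ
      ... | yes y∈σ = σ⊆τ y∈σ
      ... | no  y∉σ = subst (y ∈_) (σ∪⁅y⁆≡τ y∈ρ y∉σ) (q⊆p∪q σ ⁅ y ⁆ (x∈⁅x⁆ y))
      τ⊆ρ : τ ⊆ ρ
      τ⊆ρ = subst (_⊆ ρ) (σ∪⁅y⁆≡τ x∈ρ x∉σ) (p⊆r∧x∈r⇒p∪⁅x⁆⊆r σ⊆ρ x∈ρ)

  freePair⇔uniqueCobd : K σ → FreePair K σ τ ⇔ (∀ μ → cobd K σ μ ⇔ μ ≡ τ)
  freePair⇔uniqueCobd Kσ = mk⇔ uniqueCobd (uniqueCobd⇒freePair Kσ)
    where
    uniqueCobd : FreePair K σ τ → ∀ μ → cobd K σ μ ⇔ μ ≡ τ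
    uniqueCobd pair@(_ , _ , _ , _ , free) μ = mk⇔
      (λ { (Kμ , σ⊆μ , card) → free μ Kμ σ⊆μ (∣p∣≡1+∣q∣⇒p≢q card) })
      (λ { refl → freePair⇒cobd pair })

  facet⇔noCobd : K ν → Facet K ν ⇔ (∀ μ → ¬ cobd K ν μ)
  facet⇔noCobd {ν = ν} Kν = mk⇔ noCobd (λ noCobd → Kν , maximal noCobd)
    where
    noCobd : Facet K ν → ∀ μ → ¬ cobd K ν μ
    noCobd (_ , maximal) μ (Kμ , ν⊆μ , card) = ∣p∣≡1+∣q∣⇒p≢q card (maximal μ Kμ ν⊆μ)
    maximal : (∀ μ → ¬ cobd K ν μ) → ∀ μ → K μ → ν ⊆ μ → μ ≡ ν
    maximal noCobd μ Kμ ν⊆μ with μ ≟ₛ ν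
    ... | yes μ≡ν = μ≡ν
    ... | no  μ≢ν with ⊆∧≢⇒⊂ ν⊆μ (≢-sym μ≢ν)
    ...   | _ , x , x∈μ , x∉ν = contradiction (cobd-add Kμ ν⊆μ x∈μ x∉ν) (noCobd _)

closure-isSimplicial : IsSimplicialComplex (closure S)
closure-isSimplicial =
  (λ _ → proj₁) ,
  (λ { _ _ (_ , τ , Sτ , ν⊆τ) neμ μ⊆ν → neμ , τ , Sτ , ⊆-trans μ⊆ν ν⊆τ })

-- insert₁ L ν and insert₂ L σ τ are definitionally L ∪ᶠ (_≡ ν) and
-- L ∪ᶠ (λ μ → μ ≡ σ ⊎ μ ≡ τ).
_∪ᶠ_ : Family n → Family n → Family n
(K ∪ᶠ P) μ = K μ ⊎ P μ

module Cosimplicial (S-cosimplicial : IsCosimplicial S) where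

  private
    between : ∀ σ ν τ → S σ → S τ → σ ⊆ ν → ν ⊆ τ → S ν
    between = proj₂ S-cosimplicial

  S⊆closure : S ν → closure S ν
  S⊆closure Sν = proj₁ S-cosimplicial _ Sν , _ , Sν , ⊆-refl

  under-closed : under S ν → Nonempty μ → μ ⊆ ν → under S μ
  under-closed ((_ , τ , Sτ , ν⊆τ) , ¬Sν) neμ μ⊆ν =
    (neμ , τ , Sτ , ⊆-trans μ⊆ν ν⊆τ) , λ Sμ → ¬Sν (between _ _ τ Sμ Sτ μ⊆ν ν⊆τ)

  ¬under-above : S σ → σ ⊆ ρ → ¬ under S ρ
  ¬under-above Sσ σ⊆ρ ((_ , τ , Sτ , ρ⊆τ) , ¬Sρ) = ¬Sρ (between _ _ τ Sσ Sτ σ⊆ρ ρ⊆τ)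

  bdS-remove : S μ → S τ → μ ⊆ τ → x ∈ τ → x ∉ μ → bdS S τ (τ - x)
  bdS-remove {τ = τ} {x} Sμ Sτ μ⊆τ x∈τ x∉μ =
    (S⊆closure Sτ-x , p─q⊆p τ ⁅ x ⁆ , x∈p⇒1+∣p-x∣≡∣p∣ x∈τ) , Sτ-x
    where
    Sτ-x : S (τ - x)
    Sτ-x = between _ _ _ Sμ Sτ (p⊆q∧x∉p⇒p⊆q-x μ⊆τ x∉μ) (p─q⊆p τ ⁅ x ⁆)

  under∪ᶠ-isSimplicial⁺ : (∀ {ν} → P ν → S ν) → (∀ {μ ν} → P ν → μ ⊆ ν → P μ ⊎ ¬ S μ) →
                          IsSimplicialComplex (under S ∪ᶠ P)
  under∪ᶠ-isSimplicial⁺ {P = P} P⊆S P-closed = nonempty , closed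
    where
    nonempty : ∀ ν → (under S ∪ᶠ P) ν → Nonempty ν
    nonempty _ (inj₁ ((neν , _) , _)) = neν
    nonempty _ (inj₂ Pν)               = proj₁ S-cosimplicial _ (P⊆S Pν)
    closed : ∀ μ ν → (under S ∪ᶠ P) ν → Nonempty μ → μ ⊆ ν → (under S ∪ᶠ P) μ
    closed _ _ (inj₁ uν) neμ μ⊆ν = inj₁ (under-closed uν neμ μ⊆ν)
    closed _ ν (inj₂ Pν) neμ μ⊆ν with P-closed Pν μ⊆ν
    ... | inj₁ Pμ  = inj₂ Pμ
    ... | inj₂ ¬Sμ = inj₁ ((neμ , ν , P⊆S Pν , μ⊆ν) , ¬Sμ)

  under∪ᶠ-isSimplicial⁻ : IsSimplicialComplex (under S ∪ᶠ P) → P ν → S μ → μ ⊆ ν → P μ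
  under∪ᶠ-isSimplicial⁻ (_ , closed) Pν Sμ μ⊆ν
    with closed _ _ (inj₂ Pν) (proj₁ S-cosimplicial _ Sμ) μ⊆ν
  ... | inj₁ (_ , ¬Sμ) = contradiction Sμ ¬Sμ
  ... | inj₂ Pμ        = Pμ

  under∪ᶠ-above : S σ → (under S ∪ᶠ P) ρ → σ ⊆ ρ → P ρ
  under∪ᶠ-above Sσ (inj₁ uρ) σ⊆ρ = contradiction uρ (¬under-above Sσ σ⊆ρ)
  under∪ᶠ-above Sσ (inj₂ Pρ) σ⊆ρ = Pρ

  ¬under : S ν → ¬ under S ν
  ¬under Sν (_ , ¬Sν) = ¬Sν Sν

  module _ (coreduction : Coreduction S σ τ) (Sτ : S τ) where

    τ-x≡σ : S μ → μ ⊆ τ → x ∈ τ → x ∉ μ → τ - x ≡ σ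
    τ-x≡σ Sμ μ⊆τ x∈τ x∉μ = Equivalence.to (coreduction _) (bdS-remove Sμ Sτ μ⊆τ x∈τ x∉μ)

    S⊂τ⇒⊆σ : S μ → μ ⊂ τ → μ ⊆ σ
    S⊂τ⇒⊆σ Sμ (μ⊆τ , x , x∈τ , x∉μ) =
      subst (_ ⊆_) (τ-x≡σ Sμ μ⊆τ x∈τ x∉μ) (p⊆q∧x∉p⇒p⊆q-x μ⊆τ x∉μ)

    S⊄σ : σ ⊆ τ → S μ → ¬ μ ⊂ σ
    S⊄σ σ⊆τ Sμ (μ⊆σ , y , y∈σ , y∉μ) =
      x∉p-x τ y (subst (y ∈_) (sym (τ-x≡σ Sμ (⊆-trans μ⊆σ σ⊆τ) (σ⊆τ y∈σ) y∉μ)) y∈σ)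

    coreduction-faces : σ ⊆ τ → μ ⊆ τ → (μ ≡ σ ⊎ μ ≡ τ) ⊎ ¬ S μ
    coreduction-faces {μ = μ} σ⊆τ μ⊆τ with μ ≟ₛ τ | μ ≟ₛ σ
    ... | yes μ≡τ | _       = inj₁ (inj₂ μ≡τ)
    ... | no _    | yes μ≡σ = inj₁ (inj₁ μ≡σ)
    ... | no μ≢τ  | no μ≢σ  =
      inj₂ λ Sμ → S⊄σ σ⊆τ Sμ (⊆∧≢⇒⊂ (S⊂τ⇒⊆σ Sμ (⊆∧≢⇒⊂ μ⊆τ μ≢τ)) μ≢σ)

  coperforation-faces : Coperforation S ν → S ν → μ ⊆ ν → μ ≡ ν ⊎ ¬ S μ
  coperforation-faces {ν = ν} {μ} coperforation Sν μ⊆ν with μ ≟ₛ ν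
  ... | yes μ≡ν = inj₁ μ≡ν
  ... | no  μ≢ν with ⊆∧≢⇒⊂ μ⊆ν μ≢ν
  ...   | _ , x , x∈ν , x∉μ = inj₂ λ Sμ → coperforation _ (bdS-remove Sμ Sν μ⊆ν x∈ν x∉μ)

  elemCollapse⇔reduction : S σ → ElemCollapse (closure S) σ τ ⇔ Reduction S σ τ
  elemCollapse⇔reduction Sσ = freePair⇔uniqueCobd closure-isSimplicial (S⊆closure Sσ)

  elemPerforation⇔perforation : S ν → ElemPerforation (closure S) ν ⇔ Perforation S ν
  elemPerforation⇔perforation Sν = facet⇔noCobd closure-isSimplicial (S⊆closure Sν)

  elemExpansion⇔coreduction : S σ → S τ → σ ⊆ τ →
                              ElemExpansion (under S) σ τ ⇔ Coreduction S σ τ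
  elemExpansion⇔coreduction {σ = σ} {τ} Sσ Sτ σ⊆τ = mk⇔ to from
    where
    Pair : Family _
    Pair μ = μ ≡ σ ⊎ μ ≡ τ

    Pair⊆S : Pair ν → S ν
    Pair⊆S = [ (λ { refl → Sσ }) , (λ { refl → Sτ }) ]

    Pair⊆τ : Pair ν → ν ⊆ τ
    Pair⊆τ = [ (λ { refl → σ⊆τ }) , (λ { refl → ⊆-refl }) ]

    to : ElemExpansion (under S) σ τ → Coreduction S σ τ
    to (K-simplicial , pair , _) μ =
      mk⇔ bdSτ⇒≡σ (λ { refl → (S⊆closure Sσ , σ⊆τ , sym ∣τ∣≡1+∣σ∣) , Sσ })
      where
      ∣τ∣≡1+∣σ∣ : ∣ τ ∣ ≡ suc ∣ σ ∣
      ∣τ∣≡1+∣σ∣ = proj₂ (proj₂ (freePair⇒cobd K-simplicial pair))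
      bdSτ⇒≡σ : bdS S τ μ → μ ≡ σ
      bdSτ⇒≡σ ((_ , μ⊆τ , card) , Sμ)
        with under∪ᶠ-isSimplicial⁻ {P = Pair} K-simplicial (inj₂ refl) Sμ μ⊆τ
      ... | inj₁ μ≡σ = μ≡σ
      ... | inj₂ μ≡τ = contradiction (sym μ≡τ) (∣p∣≡1+∣q∣⇒p≢q (sym card))

    from : Coreduction S σ τ → ElemExpansion (under S) σ τ
    from coreduction = K-simplicial , (inj₂ (inj₁ refl) , inj₂ (inj₂ refl) , σ⊆τ , σ≢τ , free) ,
                       ¬under Sσ , ¬under Sτ
      where
      K-simplicial : IsSimplicialComplex (under S ∪ᶠ Pair)
      K-simplicial = under∪ᶠ-isSimplicial⁺ Pair⊆S
        (λ Pν μ⊆ν → coreduction-faces coreduction Sτ σ⊆τ (⊆-trans μ⊆ν (Pair⊆τ Pν)))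
      ∣σ∣+1≡∣τ∣ : suc ∣ σ ∣ ≡ ∣ τ ∣
      ∣σ∣+1≡∣τ∣ = proj₂ (proj₂ (proj₁ (Equivalence.from (coreduction σ) refl)))
      σ≢τ : σ ≢ τ
      σ≢τ = ≢-sym (∣p∣≡1+∣q∣⇒p≢q (sym ∣σ∣+1≡∣τ∣))
      free : ∀ ρ → (under S ∪ᶠ Pair) ρ → σ ⊆ ρ → ρ ≢ σ → ρ ≡ τ
      free ρ Kρ σ⊆ρ ρ≢σ =
        [ (λ ρ≡σ → contradiction ρ≡σ ρ≢σ) , id ] (under∪ᶠ-above {P = Pair} Sσ Kρ σ⊆ρ)

  elemFilling⇔coperforation : S ν → ElemFilling (under S) ν ⇔ Coperforation S ν
  elemFilling⇔coperforation {ν = ν} Sν = mk⇔ to from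
    where
    to : ElemFilling (under S) ν → Coperforation S ν
    to (K-simplicial , _ , _) μ ((_ , μ⊆ν , card) , Sμ) =
      ∣p∣≡1+∣q∣⇒p≢q (sym card) (sym (under∪ᶠ-isSimplicial⁻ {P = _≡ ν} K-simplicial refl Sμ μ⊆ν))
    from : Coperforation S ν → ElemFilling (under S) ν
    from coperforation =
      under∪ᶠ-isSimplicial⁺ (λ { refl → Sν })
        (λ { refl μ⊆ν → coperforation-faces coperforation Sν μ⊆ν }) ,
      (inj₂ refl , λ μ Kμ ν⊆μ → under∪ᶠ-above {P = _≡ ν} Sν Kμ ν⊆μ) ,
      ¬under Sν

proposition3 : (n : ℕ) (S : Family n) → IsCosimplicial S →
    (σ τ ν : Subset n) → S σ → S τ → S ν → σ ⊆ τ →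
      (ElemCollapse (closure S) σ τ ⇔ Reduction S σ τ) ×
      (ElemPerforation (closure S) ν ⇔ Perforation S ν) ×
      (ElemExpansion (under S) σ τ ⇔ Coreduction S σ τ) ×
      (ElemFilling (under S) ν ⇔ Coperforation S ν)
proposition3 _ _ S-cosimplicial _ _ _ Sσ Sτ Sν σ⊆τ =
  elemCollapse⇔reduction Sσ ,
  elemPerforation⇔perforation Sν ,
  elemExpansion⇔coreduction Sσ Sτ σ⊆τ ,
  elemFilling⇔coperforation Sν
  where open Cosimplicial S-cosimplicial
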